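{- Let $T:\{0,1\}^*\to\{0,1\}^*$ be an aperiodic, marked morphism. Let $x\in\{0,1\}^{\mathbb{Z}}$ be a bi-infinite word such that $T$ is recognizable in the sense of Mossé for $x$, and let $\ell$ be a constant witnessing this recognizability. Let $L=2\ell+\max\{|T(0)|,|T(1)|\}$. Then every factor $w$ of $T(x)$ with $|w|\ge L$ has a unique interpretation in $x$.
   Context: A binary morphism $T$ is marked if $T(0)$ and $T(1)$ begin with different letters and end with different letters; it is aperiodic if $T(0)$ and $T(1)$ are not powers of a common word. For a bi-infinite word $x=\cdots x_{ -1}x_0x_1\cdots$ and a non-erasing morphism $\theta$, with $y=\theta(x)$ (indexed so that $y[0]$ is the first letter of $\theta(x_0)$), the set of cutting points is $C(\theta,x)=\{0\}\cup\{|\theta(x[0,i])|: i\ge 0\}\cup\{ -|\theta(x[-i,-1])|: i>0\}$. The morphism $\theta$ is recognizable in the sense of Mossé for $x$ if there exists $\ell$ such that for every $m\in C(\theta,x)$ and $m'\in\mathbb{Z}$, the equality $y[m-\ell,m+\ell-1]=y[m'-\ell,m'+\ell-1]$ implies $m'\in C(\theta,x)$; such an $\ell$ is a witnessing constant. For a non-empty factor $w$ of $\theta(x)$, an interpretation of $w$ in $x$ is a triple $(p,z,s)$ where $z=z_0\cdots z_{n-1}$ is a factor of $x$, $p$ is a proper prefix of $\theta(z_0)$, $s$ is a proper suffix of $\theta(z_{n-1})$, and $\theta(z)=pws$. -}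

module Defs where

open import Data.Bool using (Bool; true; false; if_then_else_)
open import Data.Nat as ℕ using (ℕ; zero; suc; _<_; _⊔_)
open import Data.Integer as ℤ using (ℤ; +_; -[1+_]; -_)
open import Data.List using (List; []; _∷_; _++_; _∷ʳ_; length; concat; concatMap; replicate; lookup)
open import Data.Fin using (Fin; toℕ)
open import Data.Product using (Σ; ∃; ∃-syntax; _×_; _,_)
open import Relation.Binary.PropositionalEquality using (_≡_; _≢_)
open import Relation.Nullary using (¬_)

-- Alphabet {0,1} is Bool (false = 0, true = 1).
-- A binary morphism is determined by its images of the two letters.
Morphism : Set
Morphism = Bool → List Bool

img : Morphism → List Bool → List Bool
img T z = concatMap T z

pow : List Bool → ℕ → List Bool
pow u m = concat (replicate m u)

Marked : Morphism → Set
Marked T =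
  (∃[ a₀ ] ∃[ r₀ ] ∃[ a₁ ] ∃[ r₁ ]
     (T false ≡ a₀ ∷ r₀ × T true ≡ a₁ ∷ r₁ × a₀ ≢ a₁))
  × (∃[ r₀ ] ∃[ b₀ ] ∃[ r₁ ] ∃[ b₁ ]
     (T false ≡ r₀ ∷ʳ b₀ × T true ≡ r₁ ∷ʳ b₁ × b₀ ≢ b₁))

Aperiodic : Morphism → Set
Aperiodic T = ¬ (∃[ u ] ∃[ m ] ∃[ n ] (T false ≡ pow u m × T true ≡ pow u n))

BiWord : Set
BiWord = ℤ → Bool

sumPos : Morphism → BiWord → ℕ → ℕ
sumPos T x zero = 0
sumPos T x (suc n) = sumPos T x n ℕ.+ length (T (x (+ n)))

sumNeg : Morphism → BiWord → ℕ → ℕ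
sumNeg T x zero = 0
sumNeg T x (suc n) = sumNeg T x n ℕ.+ length (T (x -[1+ n ]))

-- cut T x n = position in T(x) where the block T(x_n) starts
-- (cut 0 = 0, cut (i+1) = |T(x[0,i])|, cut (-i) = -|T(x[-i,-1])|)
cut : Morphism → BiWord → ℤ → ℤ
cut T x (+ n) = + sumPos T x n
cut T x -[1+ n ] = - (+ sumNeg T x (suc n))

IsCut : Morphism → BiWord → ℤ → Set
IsCut T x m = ∃[ n ] (cut T x n ≡ m)

-- y = T(x), indexed so that y[0] is the first letter of T(x_0):
-- the block T(x_n) is written starting at position cut n.
IsImage : Morphism → BiWord → BiWord → Set
IsImage T x y = ∀ (n : ℤ) (j : Fin (length (T (x n)))) →
  y (cut T x n ℤ.+ + toℕ j) ≡ lookup (T (x n)) j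

MosseRecognizable : Morphism → BiWord → BiWord → ℕ → Set
MosseRecognizable T x y ℓ = ∀ (m m' : ℤ) → IsCut T x m →
  (∀ (i : ℕ) → i < 2 ℕ.* ℓ →
     y (m ℤ.- + ℓ ℤ.+ + i) ≡ y (m' ℤ.- + ℓ ℤ.+ + i)) →
  IsCut T x m'

FactorOf : BiWord → List Bool → Set
FactorOf y w = ∃[ k ] (∀ (i : Fin (length w)) → y (k ℤ.+ + toℕ i) ≡ lookup w i)

Interpretation : Morphism → BiWord → List Bool → (List Bool × List Bool × List Bool) → Set
Interpretation T x w (p , z , s) =
  FactorOf x z
  × (∃[ z₀ ] ∃[ zs ] (z ≡ z₀ ∷ zs × ∃[ r ] ∃[ c ] (p ++ (c ∷ r) ≡ T z₀)))
  × (∃[ zs ] ∃[ zₗ ] (z ≡ zs ∷ʳ zₗ × ∃[ r ] ∃[ c ] ((c ∷ r) ++ s ≡ T zₗ)))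
  × img T z ≡ p ++ w ++ s

UniqueInterpretation : Morphism → BiWord → List Bool → Set
UniqueInterpretation T x w =
  ∃[ t ] (Interpretation T x w t × (∀ t' → Interpretation T x w t' → t' ≡ t))

module Submission where

-- Every position of y = T(x) lies in some block T(xₙ), so an occurrence of w is covered by the
-- images of consecutive letters of x, which gives an interpretation. For uniqueness, markedness
-- makes T injective on first letters and, through the mirror image, on last letters; hence two
-- interpretations that cut w at the same offset c coincide, because the parts of w before and
-- after c parse uniquely. Such a common offset exists: the first interpretation has a cutting
-- point at some offset c with ℓ ≤ c < ℓ + max |T(a)|, the 2ℓ letters of y around it lie inside w
-- since |w| ≥ L, and recognizability carries it to the same offset of the second occurrence.

open import Defs
open import Data.Bool using (Bool; true; false)
open import Data.Nat as ℕ using (ℕ; zero; suc; _+_; _*_; _≤_; _<_; _⊔_; z≤n; s≤s)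
import Data.Nat.Properties as ℕ
open import Data.Integer as ℤ using (ℤ; +_; -[1+_]; -_)
import Data.Integer.Properties as ℤ
open import Data.Integer.Tactic.RingSolver using (solve-∀)
open import Data.List using (List; []; _∷_; _++_; _∷ʳ_; length; lookup; reverse; take; drop)
open import Data.List.Properties
open import Data.Fin using (Fin; toℕ; fromℕ<) renaming (zero to fzero; suc to fsuc)
open import Data.Fin.Properties using (toℕ-fromℕ<)
open import Data.Product using (∃-syntax; _×_; _,_; proj₁; proj₂)
import Data.Product as Product
open import Data.Sum using (_⊎_; inj₁; inj₂)
open import Data.Unit using (⊤; tt)
open import Data.Empty using (⊥-elim)
open import Relation.Binary.PropositionalEquality
open import Relation.Nullary using (¬_; yes; no)

ProperPrefix : ∀ {A : Set} → List A → List A → Set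
ProperPrefix p t = ∃[ r ] ∃[ c ] (p ++ (c ∷ r) ≡ t)

ProperSuffix : ∀ {A : Set} → List A → List A → Set
ProperSuffix s t = ∃[ r ] ∃[ c ] ((c ∷ r) ++ s ≡ t)

++-injective : ∀ {A : Set} (a b c d : List A) →
               length a ≡ length c → a ++ b ≡ c ++ d → a ≡ c × b ≡ d
++-injective []      b []      d _   eq = refl , eq
++-injective (x ∷ a) b (y ∷ c) d |a|≡|c| eq
  with refl , eq′ ← ∷-injective eq
  with refl , refl ← ++-injective a b c d (ℕ.suc-injective |a|≡|c|) eq′ = refl , refl

++-≤-split : ∀ {A : Set} (a b c d : List A) →
             length a ≤ length c → a ++ b ≡ c ++ d → ∃[ m ] (c ≡ a ++ m × b ≡ m ++ d)
++-≤-split []      b c       d _         eq = c , refl , eq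
++-≤-split (x ∷ a) b (y ∷ c) d (s≤s a≤c) eq
  with refl , eq′ ← ∷-injective eq
  with m , refl , b≡ ← ++-≤-split a b c d a≤c eq′ = m , refl , b≡

++-split-at : ∀ {A : Set} (a b p w s : List A) c → c ≤ length w → length a ≡ length p + c →
              a ++ b ≡ p ++ w ++ s → a ≡ p ++ take c w × b ≡ drop c w ++ s
++-split-at a b p w s c c≤|w| |a|≡ eq = ++-injective a b (p ++ take c w) (drop c w ++ s) |a|≡|p++take| (begin
  a ++ b                               ≡⟨ eq ⟩
  p ++ w ++ s                          ≡⟨ cong (λ w′ → p ++ w′ ++ s) (sym (take++drop≡id c w)) ⟩
  p ++ (take c w ++ drop c w) ++ s     ≡⟨ cong (p ++_) (++-assoc (take c w) (drop c w) s) ⟩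
  p ++ take c w ++ drop c w ++ s       ≡⟨ sym (++-assoc p (take c w) (drop c w ++ s)) ⟩
  (p ++ take c w) ++ drop c w ++ s     ∎)
  where
  open ≡-Reasoning
  |a|≡|p++take| : length a ≡ length (p ++ take c w)
  |a|≡|p++take| = trans |a|≡ (sym (trans (length-++ p) (cong (length p ℕ.+_)
                    (trans (length-take c w) (ℕ.m≤n⇒m⊓n≡m c≤|w|)))))

∷ʳ-suffix : ∀ {A : Set} (u v zs : List A) a → u ++ v ≡ zs ∷ʳ a → v ≡ [] ⊎ ∃[ vs ] (v ≡ vs ∷ʳ a)
∷ʳ-suffix []      v zs       a eq = inj₂ (zs , eq)
∷ʳ-suffix (_ ∷ u) v []       a eq = inj₁ (++-conicalʳ u v (∷-injectiveʳ eq))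
∷ʳ-suffix (_ ∷ u) v (_ ∷ zs) a eq = ∷ʳ-suffix u v zs a (∷-injectiveʳ eq)

∷ʳ-as-∷ : ∀ {A : Set} (r : List A) c → ∃[ c′ ] ∃[ r′ ] (r ∷ʳ c ≡ c′ ∷ r′)
∷ʳ-as-∷ []      c = c , [] , refl
∷ʳ-as-∷ (x ∷ r) c = x , r ∷ʳ c , refl

take-properPrefix : ∀ {A : Set} (l : List A) {j} → j < length l → ProperPrefix (take j l) l
take-properPrefix (a ∷ l) {zero}  _         = l , a , refl
take-properPrefix (a ∷ l) {suc j} (s≤s j<|l|)
  with r , c , eq ← take-properPrefix l j<|l| = r , c , cong (a ∷_) eq

drop-properSuffix : ∀ {A : Set} (l : List A) {j} → j < length l → ProperSuffix (drop (suc j) l) l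
drop-properSuffix (a ∷ l) {j} _ = take j l , a , cong (a ∷_) (take++drop≡id j l)

take-suc-fromℕ< : ∀ {A : Set} (l : List A) {j} (j<|l| : j < length l) →
                  take (suc j) l ≡ take j l ∷ʳ lookup l (fromℕ< j<|l|)
take-suc-fromℕ< (a ∷ l) {zero}  _           = refl
take-suc-fromℕ< (a ∷ l) {suc j} (s≤s j<|l|) = cong (a ∷_) (take-suc-fromℕ< l j<|l|)

suc[i+n]≡i+[1+n] : ∀ (i : ℤ) n → ℤ.suc (i ℤ.+ + n) ≡ i ℤ.+ + suc n
suc[i+n]≡i+[1+n] i n = swap i (+ n)
  where
  swap : ∀ (i j : ℤ) → ℤ.1ℤ ℤ.+ (i ℤ.+ j) ≡ i ℤ.+ (ℤ.1ℤ ℤ.+ j)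
  swap = solve-∀

i+[1+n]≡suc[i]+n : ∀ (i : ℤ) n → i ℤ.+ + suc n ≡ ℤ.suc i ℤ.+ + n
i+[1+n]≡suc[i]+n i n = trans (sym (suc[i+n]≡i+[1+n] i n)) (sym (ℤ.+-assoc ℤ.1ℤ i (+ n)))

i+∣j-i∣≡j : ∀ {i j : ℤ} → i ℤ.≤ j → i ℤ.+ + ℤ.∣ j ℤ.- i ∣ ≡ j
i+∣j-i∣≡j {i} {j} i≤j = trans (cong (λ k → i ℤ.+ k) (ℤ.0≤i⇒+∣i∣≡i (ℤ.i≤j⇒0≤j-i i≤j))) (diff i j)
  where
  diff : ∀ (i j : ℤ) → i ℤ.+ (j ℤ.- i) ≡ j
  diff = solve-∀

Occurs : BiWord → ℤ → List Bool → Set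
Occurs f k []      = ⊤
Occurs f k (a ∷ w) = f k ≡ a × Occurs f (ℤ.suc k) w

factor⇒occurs : ∀ {f k} w → (∀ (i : Fin (length w)) → f (k ℤ.+ + toℕ i) ≡ lookup w i) → Occurs f k w
factor⇒occurs []      _ = tt
factor⇒occurs {f} {k} (a ∷ w) h =
  trans (cong f (sym (ℤ.+-identityʳ k))) (h fzero) ,
  factor⇒occurs w (λ i → trans (cong f (sym (i+[1+n]≡suc[i]+n k (toℕ i)))) (h (fsuc i)))

occurs⇒factor : ∀ {f k} w → Occurs f k w → ∀ (i : Fin (length w)) → f (k ℤ.+ + toℕ i) ≡ lookup w i
occurs⇒factor {f} {k} (a ∷ w) (fk≡a , _) fzero    = trans (cong f (ℤ.+-identityʳ k)) fk≡a
occurs⇒factor {f} {k} (a ∷ w) (_ , occ)  (fsuc i) = trans (cong f (i+[1+n]≡suc[i]+n k (toℕ i))) (occurs⇒factor w occ i)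

occurs-++⁻ : ∀ {f k} u v → Occurs f k (u ++ v) → Occurs f k u × Occurs f (k ℤ.+ + length u) v
occurs-++⁻ {f} {k} []      v occ = tt , subst (λ i → Occurs f i v) (sym (ℤ.+-identityʳ k)) occ
occurs-++⁻ {f} {k} (a ∷ u) v (fk≡a , occ) with occ-u , occ-v ← occurs-++⁻ u v occ =
  (fk≡a , occ-u) , subst (λ i → Occurs f i v) (sym (i+[1+n]≡suc[i]+n k (length u))) occ-v

occurs-++⁺ : ∀ {f k} u v → Occurs f k u → Occurs f (k ℤ.+ + length u) v → Occurs f k (u ++ v)
occurs-++⁺ {f} {k} []      v _            occ-v = subst (λ i → Occurs f i v) (ℤ.+-identityʳ k) occ-v
occurs-++⁺ {f} {k} (a ∷ u) v (fk≡a , occ-u) occ-v =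
  fk≡a , occurs-++⁺ u v occ-u (subst (λ i → Occurs f i v) (i+[1+n]≡suc[i]+n k (length u)) occ-v)

occurs-same-letter : ∀ {f g k₁ k₂} w → Occurs f k₁ w → Occurs g k₂ w →
                     ∀ {j} → j < length w → f (k₁ ℤ.+ + j) ≡ g (k₂ ℤ.+ + j)
occurs-same-letter {f} {g} {k₁} {k₂} w occ₁ occ₂ {j} j<|w| =
  subst (λ i → f (k₁ ℤ.+ + i) ≡ g (k₂ ℤ.+ + i)) (toℕ-fromℕ< j<|w|)
    (trans (occurs⇒factor w occ₁ i) (sym (occurs⇒factor w occ₂ i)))
  where
  i : Fin (length w)
  i = fromℕ< j<|w|

img-++ : ∀ (S : Morphism) u v → img S (u ++ v) ≡ img S u ++ img S v
img-++ S = concatMap-++ S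

StartsWithin : Morphism → List Bool → List Bool → Set
StartsWithin S z p = ∃[ z₀ ] ∃[ zs ] (z ≡ z₀ ∷ zs × ProperPrefix p (S z₀))

EndsWithin : Morphism → List Bool → List Bool → Set
EndsWithin S z s = ∃[ zs ] ∃[ zₗ ] (z ≡ zs ∷ʳ zₗ × ProperSuffix s (S zₗ))

EmptyOrStartsWithin : Morphism → List Bool → List Bool → Set
EmptyOrStartsWithin S u p = u ≡ [] ⊎ StartsWithin S u p

EmptyOrEndsWithin : Morphism → List Bool → List Bool → Set
EmptyOrEndsWithin S v s = v ≡ [] ⊎ EndsWithin S v s

record LeftMarked (S : Morphism) : Set where
  field
    first           : Bool → Bool
    first-image     : ∀ a → ∃[ r ] (S a ≡ first a ∷ r)
    first-injective : ∀ {a b} → first a ≡ first b → a ≡ b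

leftMarked⇒nonempty : ∀ {S} → LeftMarked S → ∀ a → 0 < length (S a)
leftMarked⇒nonempty marked a with _ , Sa≡ ← LeftMarked.first-image marked a =
  subst (λ t → 0 < length t) (sym Sa≡) (s≤s z≤n)

mirror : Morphism → Morphism
mirror S a = reverse (S a)

distinct-firsts⇒leftMarked : ∀ {S a₀ a₁ r₀ r₁} → S false ≡ a₀ ∷ r₀ → S true ≡ a₁ ∷ r₁ → a₀ ≢ a₁ →
                             LeftMarked S
distinct-firsts⇒leftMarked {S} {a₀} {a₁} {r₀} {r₁} S0 S1 a₀≢a₁ = record
  { first = first ; first-image = first-image ; first-injective = first-injective }
  where
  first : Bool → Bool
  first false = a₀
  first true  = a₁
  first-image : ∀ a → ∃[ r ] (S a ≡ first a ∷ r)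
  first-image false = r₀ , S0
  first-image true  = r₁ , S1
  first-injective : ∀ {a b} → first a ≡ first b → a ≡ b
  first-injective {false} {false} _  = refl
  first-injective {false} {true}  eq = ⊥-elim (a₀≢a₁ eq)
  first-injective {true}  {false} eq = ⊥-elim (a₀≢a₁ (sym eq))
  first-injective {true}  {true}  _  = refl

marked⇒leftMarked : ∀ {T} → Marked T → LeftMarked T × LeftMarked (mirror T)
marked⇒leftMarked {T} ((_ , _ , _ , _ , T0 , T1 , a₀≢a₁) , (r₀ , b₀ , r₁ , b₁ , T0′ , T1′ , b₀≢b₁)) =
  distinct-firsts⇒leftMarked T0 T1 a₀≢a₁ ,
  distinct-firsts⇒leftMarked (reverse-snoc T0′) (reverse-snoc T1′) b₀≢b₁
  where
  reverse-snoc : ∀ {t r b} → t ≡ r ∷ʳ b → reverse t ≡ b ∷ reverse r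
  reverse-snoc {r = r} {b} refl = reverse-++ r (b ∷ [])

endsWithin-length : ∀ {S v s} → EndsWithin S v s → length s < length (img S v)
endsWithin-length {S} {s = s} (vs , a , refl , r , c , cr++s≡Sa) = begin-strict
  length s                         <⟨ ℕ.m<n+m (length s) (s≤s z≤n) ⟩
  length (c ∷ r) + length s        ≡⟨ sym (length-++ (c ∷ r)) ⟩
  length ((c ∷ r) ++ s)            ≡⟨ cong length (trans cr++s≡Sa (sym (++-identityʳ (S a)))) ⟩
  length (img S (a ∷ []))          ≤⟨ length-++-≤ʳ (img S (a ∷ [])) {img S vs} ⟩
  length (img S vs ++ img S (a ∷ [])) ≡⟨ cong length (sym (img-++ S vs (a ∷ []))) ⟩
  length (img S (vs ∷ʳ a))         ∎
  where open ℕ.≤-Reasoning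

emptyOrEndsWithin-tail : ∀ {S a v s} → EmptyOrEndsWithin S (a ∷ v) s → EmptyOrEndsWithin S v s
emptyOrEndsWithin-tail (inj₂ ([] , b , eq , suf))
  with refl ← ∷-injectiveʳ eq = inj₁ refl
emptyOrEndsWithin-tail (inj₂ (_ ∷ vs , b , eq , suf))
  with refl ← ∷-injectiveʳ eq = inj₂ (vs , b , refl , suf)

image-not-in-suffix : ∀ {S v s} m → EmptyOrEndsWithin S v s → s ≡ m ++ img S v → v ≡ []
image-not-in-suffix     m (inj₁ v≡[]) _    = v≡[]
image-not-in-suffix {S} {v} m (inj₂ e) refl =
  ⊥-elim (ℕ.<⇒≱ (endsWithin-length e) (length-++-≤ʳ (img S v) {m}))

module _ {S : Morphism} (marked : LeftMarked S) where
  open LeftMarked marked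

  first-letter : ∀ a t {c u} → S a ++ t ≡ c ∷ u → first a ≡ c
  first-letter a t eq with r , Sa≡ ← first-image a = ∷-injectiveˡ (trans (cong (_++ t) (sym Sa≡)) eq)

  suffix-parse-unique : ∀ v₁ v₂ W {s₁ s₂} → EmptyOrEndsWithin S v₁ s₁ → EmptyOrEndsWithin S v₂ s₂ →
                        img S v₁ ≡ W ++ s₁ → img S v₂ ≡ W ++ s₂ → v₁ ≡ v₂ × s₁ ≡ s₂
  suffix-parse-unique [] v₂ W {s₁} _ e₂ eq₁ eq₂
    with refl ← ++-conicalˡ W s₁ (sym eq₁) | refl ← ++-conicalʳ W s₁ (sym eq₁)
    with refl ← image-not-in-suffix [] e₂ (sym eq₂) = refl , eq₂
  suffix-parse-unique (a ∷ v₁) [] W {s₂ = s₂} e₁ _ eq₁ eq₂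
    with refl ← ++-conicalˡ W s₂ (sym eq₂) | refl ← ++-conicalʳ W s₂ (sym eq₂)
    with () ← image-not-in-suffix [] e₁ (sym eq₁)
  suffix-parse-unique (a ∷ v₁) (b ∷ v₂) [] e₁ e₂ eq₁ eq₂
    with () ← image-not-in-suffix [] e₁ (sym eq₁)
  suffix-parse-unique (a ∷ v₁) (b ∷ v₂) W@(_ ∷ _) {s₁} {s₂} e₁ e₂ eq₁ eq₂
    with refl ← first-injective (trans (first-letter a _ eq₁) (sym (first-letter b _ eq₂)))
    with ℕ.≤-total (length (S a)) (length W)
  ... | inj₁ |Sa|≤|W|
    with m₁ , W≡₁ , eq₁′ ← ++-≤-split (S a) (img S v₁) W s₁ |Sa|≤|W| eq₁
       | m₂ , W≡₂ , eq₂′ ← ++-≤-split (S a) (img S v₂) W s₂ |Sa|≤|W| eq₂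
    with refl ← ++-cancelˡ (S a) m₁ m₂ (trans (sym W≡₁) W≡₂)
    with refl , refl ← suffix-parse-unique v₁ v₂ m₁ (emptyOrEndsWithin-tail e₁) (emptyOrEndsWithin-tail e₂) eq₁′ eq₂′
    = refl , refl
  ... | inj₂ |W|≤|Sa|
    with m₁ , Sa≡₁ , refl ← ++-≤-split W s₁ (S a) (img S v₁) |W|≤|Sa| (sym eq₁)
       | m₂ , Sa≡₂ , refl ← ++-≤-split W s₂ (S a) (img S v₂) |W|≤|Sa| (sym eq₂)
    with refl ← ++-cancelˡ W m₁ m₂ (trans (sym Sa≡₁) Sa≡₂)
    with refl ← image-not-in-suffix m₁ (emptyOrEndsWithin-tail e₁) refl
       | refl ← image-not-in-suffix m₁ (emptyOrEndsWithin-tail e₂) refl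
    = refl , refl

reverse-img : ∀ S u → reverse (img S u) ≡ img (mirror S) (reverse u)
reverse-img S []      = refl
reverse-img S (a ∷ u) = begin
  reverse (S a ++ img S u)                      ≡⟨ reverse-++ (S a) (img S u) ⟩
  reverse (img S u) ++ reverse (S a)            ≡⟨ cong₂ _++_ (reverse-img S u) (sym (++-identityʳ (reverse (S a)))) ⟩
  img (mirror S) (reverse u) ++ img (mirror S) (a ∷ []) ≡⟨ sym (img-++ (mirror S) (reverse u) (a ∷ [])) ⟩
  img (mirror S) (reverse u ∷ʳ a)               ≡⟨ cong (img (mirror S)) (sym (unfold-reverse a u)) ⟩
  img (mirror S) (reverse (a ∷ u))              ∎
  where open ≡-Reasoning

emptyOrStartsWithin-mirror : ∀ {S u p} → EmptyOrStartsWithin S u p →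
                             EmptyOrEndsWithin (mirror S) (reverse u) (reverse p)
emptyOrStartsWithin-mirror (inj₁ refl) = inj₁ refl
emptyOrStartsWithin-mirror {S} {p = p} (inj₂ (a , us , refl , r , c , p++cr≡Sa))
  with c′ , r′ , rr∷ʳc≡ ← ∷ʳ-as-∷ (reverse r) c =
  inj₂ (reverse us , a , unfold-reverse a us , r′ , c′ , (begin
    (c′ ∷ r′) ++ reverse p        ≡⟨ cong (_++ reverse p) (sym rr∷ʳc≡) ⟩
    (reverse r ∷ʳ c) ++ reverse p ≡⟨ cong (_++ reverse p) (sym (unfold-reverse c r)) ⟩
    reverse (c ∷ r) ++ reverse p  ≡⟨ sym (reverse-++ p (c ∷ r)) ⟩
    reverse (p ++ c ∷ r)          ≡⟨ cong reverse p++cr≡Sa ⟩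
    reverse (S a)                 ∎))
  where open ≡-Reasoning

prefix-parse-unique : ∀ {S} → LeftMarked (mirror S) →
                      ∀ u₁ u₂ W {p₁ p₂} → EmptyOrStartsWithin S u₁ p₁ → EmptyOrStartsWithin S u₂ p₂ →
                      img S u₁ ≡ p₁ ++ W → img S u₂ ≡ p₂ ++ W → u₁ ≡ u₂ × p₁ ≡ p₂
prefix-parse-unique {S} marked u₁ u₂ W e₁ e₂ eq₁ eq₂ =
  Product.map reverse-injective reverse-injective
    (suffix-parse-unique marked (reverse u₁) (reverse u₂) (reverse W)
      (emptyOrStartsWithin-mirror e₁) (emptyOrStartsWithin-mirror e₂) (mirrored {u₁} eq₁) (mirrored {u₂} eq₂))
  where
  mirrored : ∀ {u p} → img S u ≡ p ++ W → img (mirror S) (reverse u) ≡ reverse W ++ reverse p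
  mirrored {u} {p} eq = trans (sym (reverse-img S u)) (trans (cong reverse eq) (reverse-++ p W))

startsWithin-prefix : ∀ {S} u v {p} → StartsWithin S (u ++ v) p → EmptyOrStartsWithin S u p
startsWithin-prefix []      v _ = inj₁ refl
startsWithin-prefix (a ∷ u) v (_ , _ , eq , prefix)
  with refl ← ∷-injectiveˡ eq = inj₂ (a , u , refl , prefix)

endsWithin-suffix : ∀ {S} u v {s} → EndsWithin S (u ++ v) s → EmptyOrEndsWithin S v s
endsWithin-suffix u v (zs , a , eq , suffix) with ∷ʳ-suffix u v zs a eq
... | inj₁ v≡[]       = inj₁ v≡[]
... | inj₂ (vs , v≡) = inj₂ (vs , a , v≡ , suffix)

endsWithin-∷ : ∀ {S a z s} → EndsWithin S z s → EndsWithin S (a ∷ z) s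
endsWithin-∷ {a = a} (zs , b , refl , suffix) = a ∷ zs , b , refl , suffix

prefix-image-in-window : ∀ {S M} → (∀ a → length (S a) ≤ M) → 0 < M →
                         ∀ z a → a ≤ length (img S z) →
                         ∃[ u ] ∃[ v ] ∃[ e ] (z ≡ u ++ v × length (img S u) ≡ a + e × e < M)
prefix-image-in-window         _ M>0 z       zero    _ = [] , z , 0 , refl , refl , M>0
prefix-image-in-window {S} {M} bounded M>0 (b ∷ z) (suc a) a<|img| with suc a ℕ.≤? length (S b)
... | yes a<|Sb| with e , a+e≡ ← ℕ.m≤n⇒∃[o]m+o≡n a<|Sb| =
  b ∷ [] , z , e , refl , trans (cong length (++-identityʳ (S b))) (sym a+e≡) ,
  ℕ.<-≤-trans (ℕ.m<n+m e (s≤s z≤n)) (subst (_≤ M) (sym a+e≡) (bounded b))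
... | no a≮|Sb|
  with a′ , |Sb|+a′≡ ← ℕ.m≤n⇒∃[o]m+o≡n (ℕ.<⇒≤ (ℕ.≰⇒> a≮|Sb|))
  with u , v , e , refl , |u|≡ , e<M ← prefix-image-in-window bounded M>0 z a′
         (ℕ.+-cancelˡ-≤ (length (S b)) a′ (length (img S z))
           (subst₂ _≤_ (sym |Sb|+a′≡) (length-++ (S b)) a<|img|)) =
  b ∷ u , v , e , refl , (begin
    length (S b ++ img S u)       ≡⟨ length-++ (S b) ⟩
    length (S b) + length (img S u) ≡⟨ cong (length (S b) ℕ.+_) |u|≡ ⟩
    length (S b) + (a′ + e)       ≡⟨ sym (ℕ.+-assoc (length (S b)) a′ e) ⟩
    length (S b) + a′ + e         ≡⟨ cong (_+ e) |Sb|+a′≡ ⟩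
    suc a + e                     ∎) , e<M
  where open ≡-Reasoning

-- When S(z) = p w s, the boundary between u and v lies at offset c of w.
SplitAt : Morphism → List Bool → List Bool → ℕ → Set
SplitAt S z p c = ∃[ u ] ∃[ v ] (z ≡ u ++ v × length (img S u) ≡ length p + c)

interpretations-agree : ∀ {T x w p₁ z₁ s₁ p₂ z₂ s₂ c} → LeftMarked T → LeftMarked (mirror T) → c ≤ length w →
                        Interpretation T x w (p₁ , z₁ , s₁) → Interpretation T x w (p₂ , z₂ , s₂) →
                        SplitAt T z₁ p₁ c → SplitAt T z₂ p₂ c → (p₂ , z₂ , s₂) ≡ (p₁ , z₁ , s₁)
interpretations-agree {T} {w = w} {p₁} {s₁ = s₁} {p₂} {s₂ = s₂} {c} marked marked′ c≤|w|
  (_ , starts₁ , ends₁ , img≡₁) (_ , starts₂ , ends₂ , img≡₂) (u₁ , v₁ , refl , |u₁|≡) (u₂ , v₂ , refl , |u₂|≡)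
  with left₁ , right₁ ← ++-split-at (img T u₁) (img T v₁) p₁ w s₁ c c≤|w| |u₁|≡ (trans (sym (img-++ T u₁ v₁)) img≡₁)
     | left₂ , right₂ ← ++-split-at (img T u₂) (img T v₂) p₂ w s₂ c c≤|w| |u₂|≡ (trans (sym (img-++ T u₂ v₂)) img≡₂)
  with refl , refl ← prefix-parse-unique marked′ u₁ u₂ (take c w)
                       (startsWithin-prefix u₁ v₁ starts₁) (startsWithin-prefix u₂ v₂ starts₂) left₁ left₂
     | refl , refl ← suffix-parse-unique marked v₁ v₂ (drop c w)
                       (endsWithin-suffix u₁ v₁ ends₁) (endsWithin-suffix u₂ v₂ ends₂) right₁ right₂
  = refl

interpretation-offset : ∀ {T x w p z s c} → Interpretation T x w (p , z , s) → c ≤ length w →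
                        length p + c ≤ length (img T z)
interpretation-offset {w = w} {p} {s = s} (_ , _ , _ , img≡) c≤|w| = subst (_ ≤_) (cong length (sym img≡)) (begin
  length p + _                     ≤⟨ ℕ.+-monoʳ-≤ (length p) (ℕ.≤-trans c≤|w| (ℕ.m≤m+n (length w) (length s))) ⟩
  length p + (length w + length s) ≡⟨ cong (length p ℕ.+_) (sym (length-++ w)) ⟩
  length p + length (w ++ s)       ≡⟨ sym (length-++ p) ⟩
  length (p ++ w ++ s)             ∎)
  where open ℕ.≤-Reasoning

module Cuts (T : Morphism) (x : BiWord) where

  C : ℤ → ℤ
  C = cut T x

  L : ℤ → ℕ
  L n = length (T (x n))

  cut-suc : ∀ n → C (ℤ.suc n) ≡ C n ℤ.+ + L n
  cut-suc (+ m)            = refl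
  cut-suc -[1+ zero ]      = sym (ℤ.+-inverseˡ (+ L -[1+ zero ]))
  cut-suc -[1+ suc m ]     = sym (cancel (+ sumNeg T x (suc m)) (+ L -[1+ suc m ]))
    where
    cancel : ∀ (a b : ℤ) → - (a ℤ.+ b) ℤ.+ b ≡ - a
    cancel = solve-∀

  cut-suc-+ : ∀ k d → C (ℤ.suc k) ℤ.+ + d ≡ C k ℤ.+ + (L k ℕ.+ d)
  cut-suc-+ k d = trans (cong (ℤ._+ + d) (cut-suc k)) (ℤ.+-assoc (C k) (+ L k) (+ d))

  cut-shift : ∀ k u → Occurs x k u → C (k ℤ.+ + length u) ≡ C k ℤ.+ + length (img T u)
  cut-shift k []      _            = trans (cong C (ℤ.+-identityʳ k)) (sym (ℤ.+-identityʳ (C k)))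
  cut-shift k (a ∷ u) (refl , occ) = begin
    C (k ℤ.+ + suc (length u))                       ≡⟨ cong C (i+[1+n]≡suc[i]+n k (length u)) ⟩
    C (ℤ.suc k ℤ.+ + length u)                       ≡⟨ cut-shift (ℤ.suc k) u occ ⟩
    C (ℤ.suc k) ℤ.+ + length (img T u)               ≡⟨ cut-suc-+ k (length (img T u)) ⟩
    C k ℤ.+ + (L k ℕ.+ length (img T u))             ≡⟨ cong (λ n → C k ℤ.+ + n) (sym (length-++ (T (x k)))) ⟩
    C k ℤ.+ + length (img T (x k ∷ u))               ∎
    where open ≡-Reasoning

  cut-increasing : ∀ m j → C m ℤ.≤ C (m ℤ.+ + j)
  cut-increasing m zero    = ℤ.≤-reflexive (cong C (sym (ℤ.+-identityʳ m)))
  cut-increasing m (suc j) = begin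
    C m                       ≤⟨ ℤ.i≤i+j (C m) (+ L m) ⟩
    C m ℤ.+ + L m             ≡⟨ sym (cut-suc m) ⟩
    C (ℤ.suc m)               ≤⟨ cut-increasing (ℤ.suc m) j ⟩
    C (ℤ.suc m ℤ.+ + j)       ≡⟨ cong C (sym (i+[1+n]≡suc[i]+n m j)) ⟩
    C (m ℤ.+ + suc j)         ∎
    where open ℤ.≤-Reasoning

  cut-monotone : ∀ {m n} → m ℤ.≤ n → C m ℤ.≤ C n
  cut-monotone {m} {n} m≤n = subst (λ k → C m ℤ.≤ C k) (i+∣j-i∣≡j m≤n) (cut-increasing m ℤ.∣ n ℤ.- m ∣)

  no-cut-inside-block : ∀ k n {d} → 0 < d → d < L k → C n ≢ C k ℤ.+ + d
  no-cut-inside-block k n {d} 0<d d<L Cn≡ with n ℤ.≤? k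
  ... | yes n≤k = ℤ.<-irrefl refl (begin-strict
    C n             ≤⟨ cut-monotone n≤k ⟩
    C k             ≡⟨ sym (ℤ.+-identityʳ (C k)) ⟩
    C k ℤ.+ + 0     <⟨ ℤ.+-monoʳ-< (C k) (ℤ.+<+ 0<d) ⟩
    C k ℤ.+ + d     ≡⟨ sym Cn≡ ⟩
    C n             ∎)
    where open ℤ.≤-Reasoning
  ... | no n≰k = ℤ.<-irrefl refl (begin-strict
    C n             ≡⟨ Cn≡ ⟩
    C k ℤ.+ + d     <⟨ ℤ.+-monoʳ-< (C k) (ℤ.+<+ d<L) ⟩
    C k ℤ.+ + L k   ≡⟨ sym (cut-suc k) ⟩
    C (ℤ.suc k)     ≤⟨ cut-monotone (ℤ.i<j⇒suc[i]≤j (ℤ.≰⇒> n≰k)) ⟩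
    C n             ∎)
    where open ℤ.≤-Reasoning

  split-at-cut : ∀ k z → Occurs x k z → ∀ d → d ≤ length (img T z) → IsCut T x (C k ℤ.+ + d) →
                 ∃[ u ] ∃[ v ] (z ≡ u ++ v × length (img T u) ≡ d)
  split-at-cut k z       _            zero    _ _ = [] , z , refl , refl
  split-at-cut k (_ ∷ z) (refl , occ) (suc d) d≤|img| (n , Cn≡) with suc d ℕ.<? L k
  ... | yes d<L = ⊥-elim (no-cut-inside-block k n (s≤s z≤n) d<L Cn≡)
  ... | no d≮L
    with d′ , L+d′≡ ← ℕ.m≤n⇒∃[o]m+o≡n (ℕ.≮⇒≥ d≮L)
    with u , v , refl , |u|≡ ← split-at-cut (ℤ.suc k) z occ d′
           (ℕ.+-cancelˡ-≤ (L k) d′ (length (img T z)) (subst₂ _≤_ (sym L+d′≡) (length-++ (T (x k))) d≤|img|))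
           (n , trans Cn≡ (trans (cong (λ e → C k ℤ.+ + e) (sym L+d′≡)) (sym (cut-suc-+ k d′))))
    = x k ∷ u , v , refl , trans (length-++ (T (x k))) (trans (cong (L k ℕ.+_) |u|≡) L+d′≡)

  cut-at-block-end : ∀ n {j} → j < L n → ¬ suc j < L n → ℤ.suc (C n ℤ.+ + j) ≡ C (ℤ.suc n) ℤ.+ + 0
  cut-at-block-end n {j} j<L j+1≮L = begin
    ℤ.suc (C n ℤ.+ + j)   ≡⟨ suc[i+n]≡i+[1+n] (C n) j ⟩
    C n ℤ.+ + suc j       ≡⟨ cong (λ e → C n ℤ.+ + e) (ℕ.≤-antisym j<L (ℕ.≮⇒≥ j+1≮L)) ⟩
    C n ℤ.+ + L n         ≡⟨ sym (cut-suc n) ⟩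
    C (ℤ.suc n)           ≡⟨ sym (ℤ.+-identityʳ (C (ℤ.suc n))) ⟩
    C (ℤ.suc n) ℤ.+ + 0   ∎
    where open ≡-Reasoning

  InBlock : ℤ → Set
  InBlock K = ∃[ n ] ∃[ j ] (j < L n × K ≡ C n ℤ.+ + j)

  module _ (nonempty : ∀ a → 0 < length (T a)) where

    inBlock-suc : ∀ {K} → InBlock K → InBlock (ℤ.suc K)
    inBlock-suc (n , j , j<L , refl) with suc j ℕ.<? L n
    ... | yes j+1<L = n , suc j , j+1<L , suc[i+n]≡i+[1+n] (C n) j
    ... | no j+1≮L  = ℤ.suc n , 0 , nonempty (x (ℤ.suc n)) , cut-at-block-end n j<L j+1≮L

    inBlock-after-cut : ∀ n d → InBlock (C n ℤ.+ + d)
    inBlock-after-cut n zero    = n , 0 , nonempty (x n) , refl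
    inBlock-after-cut n (suc d) = subst InBlock (suc[i+n]≡i+[1+n] (C n) d) (inBlock-suc (inBlock-after-cut n d))

    cut-below : ∀ m → C -[1+ m ] ℤ.≤ -[1+ m ]
    cut-below m = ℤ.neg-mono-≤ (ℤ.+≤+ (sumNeg-≥ (suc m)))
      where
      sumNeg-≥ : ∀ m → m ≤ sumNeg T x m
      sumNeg-≥ zero    = z≤n
      sumNeg-≥ (suc m) = subst (_≤ sumNeg T x (suc m)) (ℕ.+-comm m 1) (ℕ.+-mono-≤ (sumNeg-≥ m) (nonempty _))

    inBlock : ∀ K → InBlock K
    inBlock (+ m)      = inBlock-after-cut (+ 0) m
    inBlock -[1+ m ] = subst InBlock (i+∣j-i∣≡j (cut-below m)) (inBlock-after-cut -[1+ m ] _)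

module Image (T : Morphism) (x y : BiWord) (image : IsImage T x y) where
  open Cuts T x

  image-occurs : ∀ k z → Occurs x k z → Occurs y (C k) (img T z)
  image-occurs k []      _            = tt
  image-occurs k (_ ∷ z) (refl , occ) =
    occurs-++⁺ (T (x k)) (img T z) (factor⇒occurs (T (x k)) (image k))
      (subst (λ i → Occurs y i (img T z)) (cut-suc k) (image-occurs (ℤ.suc k) z occ))

  interpretation-occurs : ∀ {w p z s} → Interpretation T x w (p , z , s) →
                          ∃[ k ] (Occurs x k z × Occurs y (C k ℤ.+ + length p) w)
  interpretation-occurs {w} {p} {z} {s} ((k , factor) , _ , _ , img≡) =
    k , occ-z , proj₁ (occurs-++⁻ w s (proj₂ (occurs-++⁻ p (w ++ s)
                  (subst (Occurs y (C k)) img≡ (image-occurs k z occ-z)))))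
    where
    occ-z : Occurs x k z
    occ-z = factor⇒occurs z factor

  take-suc-block : ∀ n {j a} → j < L n → y (C n ℤ.+ + j) ≡ a →
                   ∀ t → take (suc j) (T (x n)) ++ t ≡ take j (T (x n)) ++ a ∷ t
  take-suc-block n {j} {a} j<L y≡a t = begin
    take (suc j) l ++ t           ≡⟨ cong (_++ t) (take-suc-fromℕ< l j<L) ⟩
    (take j l ∷ʳ lookup l i) ++ t ≡⟨ cong (λ b → (take j l ∷ʳ b) ++ t) letter ⟩
    (take j l ∷ʳ a) ++ t          ≡⟨ ∷ʳ-++ (take j l) a t ⟩
    take j l ++ a ∷ t             ∎
    where
    open ≡-Reasoning
    l : List Bool
    l = T (x n)
    i : Fin (L n)
    i = fromℕ< j<L
    letter : lookup l i ≡ a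
    letter = trans (sym (image n i)) (trans (cong (λ e → y (C n ℤ.+ + e)) (toℕ-fromℕ< j<L)) y≡a)

  module _ (nonempty : ∀ a → 0 < length (T a)) where

    interpretation-from : ∀ n j a w → j < L n → Occurs y (C n ℤ.+ + j) (a ∷ w) →
                          ∃[ z ] ∃[ s ] (Occurs x (ℤ.suc n) z × EndsWithin T (x n ∷ z) s ×
                                         img T (x n ∷ z) ≡ take j (T (x n)) ++ a ∷ w ++ s)
    interpretation-from n j a [] j<L (y≡a , _) =
      [] , drop (suc j) (T (x n)) , tt , ([] , x n , refl , drop-properSuffix (T (x n)) j<L) ,
      trans (++-identityʳ (T (x n))) (trans (sym (take++drop≡id (suc j) (T (x n)))) (take-suc-block n j<L y≡a _))
    interpretation-from n j a (b ∷ w) j<L (y≡a , occ) with suc j ℕ.<? L n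
    ... | yes j+1<L
      with z , s , occ-z , ends , img≡ ← interpretation-from n (suc j) b w j+1<L
                                           (subst (λ i → Occurs y i (b ∷ w)) (suc[i+n]≡i+[1+n] (C n) j) occ)
      = z , s , occ-z , ends , trans img≡ (take-suc-block n j<L y≡a _)
    ... | no j+1≮L
      with z , s , occ-z , ends , img≡ ← interpretation-from (ℤ.suc n) 0 b w (nonempty _)
                                           (subst (λ i → Occurs y i (b ∷ w)) (cut-at-block-end n j<L j+1≮L) occ)
      = x (ℤ.suc n) ∷ z , s , (refl , occ-z) , endsWithin-∷ ends , (begin
        T (x n) ++ img T (x (ℤ.suc n) ∷ z)   ≡⟨ cong (T (x n) ++_) img≡ ⟩
        T (x n) ++ b ∷ w ++ s                ≡⟨ cong (_++ b ∷ w ++ s) (sym (take-all (suc j) (T (x n)) (ℕ.≮⇒≥ j+1≮L))) ⟩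
        take (suc j) (T (x n)) ++ b ∷ w ++ s ≡⟨ take-suc-block n j<L y≡a _ ⟩
        take j (T (x n)) ++ a ∷ b ∷ w ++ s   ∎)
      where open ≡-Reasoning

    interpretation-exists : ∀ w → FactorOf y w → 0 < length w → ∃[ t ] Interpretation T x w t
    interpretation-exists (a ∷ w) (K , factor) _
      with n , j , j<L , refl ← inBlock nonempty K
      with z , s , occ-z , ends , img≡ ← interpretation-from n j a w j<L (factor⇒occurs (a ∷ w) factor)
      = (take j (T (x n)) , x n ∷ z , s) ,
        (n , occurs⇒factor (x n ∷ z) (refl , occ-z)) , (x n , z , refl , take-properPrefix (T (x n)) j<L) ,
        ends , img≡

  mosse-transfer : ∀ {ℓ} → MosseRecognizable T x y ℓ → ∀ {K₁ K₂} w → Occurs y K₁ w → Occurs y K₂ w →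
                   ∀ e → e + 2 * ℓ ≤ length w → IsCut T x (K₁ ℤ.+ + (ℓ + e)) → IsCut T x (K₂ ℤ.+ + (ℓ + e))
  mosse-transfer {ℓ} recognizable {K₁} {K₂} w occ₁ occ₂ e fits cut₁ = recognizable _ _ cut₁ same-window
    where
    recenter : ∀ K i → K ℤ.+ + (ℓ + e) ℤ.- + ℓ ℤ.+ + i ≡ K ℤ.+ + (e + i)
    recenter K i = shift K (+ ℓ) (+ e) (+ i)
      where
      shift : ∀ (K L E I : ℤ) → K ℤ.+ (L ℤ.+ E) ℤ.- L ℤ.+ I ≡ K ℤ.+ (E ℤ.+ I)
      shift = solve-∀
    same-window : ∀ i → i < 2 * ℓ → y (K₁ ℤ.+ + (ℓ + e) ℤ.- + ℓ ℤ.+ + i) ≡ y (K₂ ℤ.+ + (ℓ + e) ℤ.- + ℓ ℤ.+ + i)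
    same-window i i<2ℓ = begin
      y (K₁ ℤ.+ + (ℓ + e) ℤ.- + ℓ ℤ.+ + i) ≡⟨ cong y (recenter K₁ i) ⟩
      y (K₁ ℤ.+ + (e + i))                 ≡⟨ occurs-same-letter w occ₁ occ₂ (ℕ.<-≤-trans (ℕ.+-monoʳ-< e i<2ℓ) fits) ⟩
      y (K₂ ℤ.+ + (e + i))                 ≡⟨ cong y (sym (recenter K₂ i)) ⟩
      y (K₂ ℤ.+ + (ℓ + e) ℤ.- + ℓ ℤ.+ + i) ∎
      where open ≡-Reasoning

  cut-after-prefix : ∀ k u v → Occurs x k (u ++ v) → IsCut T x (C k ℤ.+ + length (img T u))
  cut-after-prefix k u v occ = k ℤ.+ + length u , cut-shift k u (proj₁ (occurs-++⁻ u v occ))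

  common-cut : ∀ {ℓ M} → MosseRecognizable T x y ℓ → (∀ a → length (T a) ≤ M) → 0 < M →
               ∀ {w p₁ z₁ s₁ p₂ z₂ s₂} → 2 * ℓ + M ≤ length w →
               Interpretation T x w (p₁ , z₁ , s₁) → Interpretation T x w (p₂ , z₂ , s₂) →
               ∃[ c ] (c ≤ length w × SplitAt T z₁ p₁ c × SplitAt T z₂ p₂ c)
  common-cut {ℓ} {M} recognizable bounded M>0 {w} {p₁} {z₁} {s₁} {p₂} {z₂} {s₂} long I₁ I₂
    with k₁ , occx₁ , occy₁ ← interpretation-occurs I₁ | k₂ , occx₂ , occy₂ ← interpretation-occurs I₂
    with u₁ , v₁ , e , refl , |u₁|≡ , e<M ← prefix-image-in-window bounded M>0 z₁ (length p₁ + ℓ)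
                                              (interpretation-offset {x = x} I₁ (ℕ.≤-trans (ℕ.m≤m+n ℓ _) (ℕ.m+n≤o⇒m≤o (2 * ℓ) long)))
    = ℓ + e , ℓ+e≤|w| , (u₁ , v₁ , refl , trans |u₁|≡ (ℕ.+-assoc (length p₁) ℓ e)) ,
      split-at-cut k₂ z₂ occx₂ (length p₂ + (ℓ + e)) (interpretation-offset {x = x} I₂ ℓ+e≤|w|)
        (subst (IsCut T x) (ℤ.+-assoc (C k₂) (+ length p₂) (+ (ℓ + e)))
          (mosse-transfer recognizable w occy₁ occy₂ e window-fits
            (subst (IsCut T x) cut₁≡ (cut-after-prefix k₁ u₁ v₁ occx₁))))
    where
    window-fits : e + 2 * ℓ ≤ length w
    window-fits = ℕ.≤-trans (ℕ.+-monoˡ-≤ (2 * ℓ) (ℕ.<⇒≤ e<M)) (subst (_≤ length w) (ℕ.+-comm (2 * ℓ) M) long)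
    ℓ+e≤|w| : ℓ + e ≤ length w
    ℓ+e≤|w| = ℕ.≤-trans (subst (_≤ e + 2 * ℓ) (ℕ.+-comm e ℓ) (ℕ.+-monoʳ-≤ e (ℕ.m≤m+n ℓ (ℓ + 0)))) window-fits
    cut₁≡ : C k₁ ℤ.+ + length (img T u₁) ≡ C k₁ ℤ.+ + length p₁ ℤ.+ + (ℓ + e)
    cut₁≡ = trans (cong (λ n → C k₁ ℤ.+ + n) (trans |u₁|≡ (ℕ.+-assoc (length p₁) ℓ e)))
                  (sym (ℤ.+-assoc (C k₁) (+ length p₁) (+ (ℓ + e))))

lemma5 : (T : Morphism) → Aperiodic T → Marked T →
    (x y : BiWord) → IsImage T x y →
    (ℓ : ℕ) → MosseRecognizable T x y ℓ →
    (w : List Bool) → FactorOf y w →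
    2 * ℓ + (length (T false) ⊔ length (T true)) ≤ length w →
    UniqueInterpretation T x w
lemma5 T _ marked x y image ℓ recognizable w factor long =
  let t , I = interpretation-exists nonempty w factor (ℕ.<-≤-trans (ℕ.<-≤-trans M>0 (ℕ.m≤n+m M (2 * ℓ))) long)
  in t , I , λ where
    (_ , _ , _) I′ → let c , c≤|w| , split , split′ = common-cut recognizable bounded M>0 long I I′
                     in interpretations-agree {x = x} leftMarked mirrorLeftMarked c≤|w| I I′ split split′
  where
  open Image T x y image
  leftMarked : LeftMarked T
  leftMarked = proj₁ (marked⇒leftMarked {T} marked)
  mirrorLeftMarked : LeftMarked (mirror T)
  mirrorLeftMarked = proj₂ (marked⇒leftMarked {T} marked)
  nonempty : ∀ a → 0 < length (T a)
  nonempty = leftMarked⇒nonempty leftMarked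
  M : ℕ
  M = length (T false) ⊔ length (T true)
  bounded : ∀ a → length (T a) ≤ M
  bounded false = ℕ.m≤m⊔n _ _
  bounded true  = ℕ.m≤n⊔m _ _
  M>0 : 0 < M
  M>0 = ℕ.<-≤-trans (nonempty false) (bounded false)
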